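{- Let $(\Sigma,\Gamma,\mathcal U)$ be an extended many-sorted finite model finding problem and let $Q:A\to\mathrm{Bool}$ be a predicate symbol of $\Sigma$. Let $X\subseteq\mathcal U(A)$ be a value-interchangeable set for $A$, ordered as $d_1,\dots,d_m$ (distinct). Let $I$ be any interpretation of $(\Sigma,\Gamma,\mathcal U)$. Then there exists an interpretation $I'$ isomorphic to $I$ satisfying $Q(d_i)\implies Q(d_{i-1})$ for each $i=2,\dots,m$, i.e. $d_i\in I'(Q)$ implies $d_{i-1}\in I'(Q)$.
   Context: A signature $\Sigma$ consists of a finite set of sorts, a finite set of function symbols $g:A_1\times\dots\times A_n\to B$ (constants when $n=0$), and a finite set of predicate symbols $R:A_1\times\dots\times A_n\to\mathrm{Bool}$. A domain assignment $\mathcal U$ maps each sort to a nonempty finite set. An extended MSFMF problem is $(\Sigma,\Gamma,\mathcal U)$ where $\Gamma$ is a finite set of many-sorted first-order formulas (with equality) over $\Sigma$ in which every domain value $v\in\mathcal U(\theta)$ may also be used as a term of sort $\theta$ (evaluating to itself). An interpretation $I$ assigns each function symbol $g:A_1\times\dots\times A_n\to B$ a function $\mathcal U(A_1)\times\dots\times\mathcal U(A_n)\to\mathcal U(B)$ and each predicate symbol a relation on the corresponding product of domains. A domain permutation $\sigma$ is a family of permutations $\sigma_\theta$ of $\mathcal U(\theta)$, one per sort; it acts by $(\sigma\bullet I)(g)(\sigma_{A_1}(a_1),\dots,\sigma_{A_n}(a_n))=\sigma_B(I(g)(a_1,\dots,a_n))$ and $(a_1,\dots,a_n)\in I(R)\iff(\sigma_{A_1}(a_1),\dots,\sigma_{A_n}(a_n))\in(\sigma\bullet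 I)(R)$. A domain symmetry is a domain permutation $\sigma$ such that for every interpretation $I$, $\sigma\bullet I\models\Gamma$ iff $I\models\Gamma$. Interpretations $I,I'$ are isomorphic if $I'=\sigma\bullet I$ for some domain symmetry $\sigma$. A set $X\subseteq\mathcal U(\theta)$ is value-interchangeable for $\theta$ if every domain permutation $\sigma$ with $\sigma_\theta(v)=v$ for all $v\in\mathcal U(\theta)\setminus X$ and $\sigma_{\theta'}$ the identity for all sorts $\theta'\neq\theta$ is a domain symmetry. -}

module Defs where

open import Data.Nat using (ℕ; NonZero)
open import Data.Fin using (Fin)
open import Data.Fin.Permutation using (Permutation′; _⟨$⟩ʳ_; _⟨$⟩ˡ_)
import Data.Fin.Properties as FinP
open import Data.Bool using (Bool; true; false; _∧_; _∨_; not; if_then_else_)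
open import Data.List using (List; []; _∷_; allFin)
open import Data.Bool.ListAction using (all; any)
open import Data.Empty using (⊥)
open import Data.List.Membership.Propositional using (_∈_)
open import Data.List.Relation.Unary.All as All using (All; []; _∷_)
open import Data.Product using (Σ; _×_; _,_; ∃)
open import Relation.Binary.PropositionalEquality using (_≡_; _≢_; subst; sym)
open import Relation.Nullary.Decidable using (⌊_⌋)

record Signature : Set where
  field
    nSorts nFuns nPreds : ℕ
    fArgs : Fin nFuns → List (Fin nSorts)
    fRes  : Fin nFuns → Fin nSorts
    pArgs : Fin nPreds → List (Fin nSorts)

  Sort    = Fin nSorts
  FunSym  = Fin nFuns
  PredSym = Fin nPreds

record DomainAssignment (Sg : Signature) : Set where
  field
    size     : Signature.Sort Sg → ℕ
    nonEmpty : ∀ s → NonZero (size s)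

  Dom : Signature.Sort Sg → Set
  Dom s = Fin (size s)

module Syntax (Sg : Signature) (U : DomainAssignment Sg) where
  open Signature Sg
  open DomainAssignment U

  mutual
    data Term (Γ : List Sort) : Sort → Set where
      var : ∀ {s} → s ∈ Γ → Term Γ s
      val : ∀ {s} → Dom s → Term Γ s
      app : (g : FunSym) → Terms Γ (fArgs g) → Term Γ (fRes g)

    data Terms (Γ : List Sort) : List Sort → Set where
      []  : Terms Γ []
      _∷_ : ∀ {s ss} → Term Γ s → Terms Γ ss → Terms Γ (s ∷ ss)

  data Formula (Γ : List Sort) : Set where
    ⊤f ⊥f   : Formula Γ
    eqf     : ∀ {s} → Term Γ s → Term Γ s → Formula Γ
    relf    : (R : PredSym) → Terms Γ (pArgs R) → Formula Γ
    notf    : Formula Γ → Formula Γ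
    andf orf impf iff : Formula Γ → Formula Γ → Formula Γ
    allf exf : (s : Sort) → Formula (s ∷ Γ) → Formula Γ

  Sentence : Set
  Sentence = Formula []

  record Interp : Set where
    field
      fun  : (g : FunSym) → All Dom (fArgs g) → Dom (fRes g)
      pred : (R : PredSym) → All Dom (pArgs R) → Bool
  open Interp public

  _≗I_ : Interp → Interp → Set
  I ≗I J = (∀ g as → fun I g as ≡ fun J g as) × (∀ R as → pred I R as ≡ pred J R as)

  module _ (I : Interp) where
    mutual
      evalT : ∀ {Γ s} → All Dom Γ → Term Γ s → Dom s
      evalT ρ (var x)   = All.lookup ρ x
      evalT ρ (val v)   = v
      evalT ρ (app g ts) = fun I g (evalTs ρ ts)

      evalTs : ∀ {Γ ss} → All Dom Γ → Terms Γ ss → All Dom ss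
      evalTs ρ []       = []
      evalTs ρ (t ∷ ts) = evalT ρ t ∷ evalTs ρ ts

    evalF : ∀ {Γ} → All Dom Γ → Formula Γ → Bool
    evalF ρ ⊤f = true
    evalF ρ ⊥f = false
    evalF ρ (eqf t u) = ⌊ evalT ρ t FinP.≟ evalT ρ u ⌋
    evalF ρ (relf R ts) = pred I R (evalTs ρ ts)
    evalF ρ (notf φ) = not (evalF ρ φ)
    evalF ρ (andf φ ψ) = evalF ρ φ ∧ evalF ρ ψ
    evalF ρ (orf φ ψ) = evalF ρ φ ∨ evalF ρ ψ
    evalF ρ (impf φ ψ) = not (evalF ρ φ) ∨ evalF ρ ψ
    evalF ρ (iff φ ψ) = if evalF ρ φ then evalF ρ ψ else not (evalF ρ ψ)
    evalF ρ (allf s φ) = all (λ v → evalF (v ∷ ρ) φ) (allFin (size s))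
    evalF ρ (exf s φ) = any (λ v → evalF (v ∷ ρ) φ) (allFin (size s))

  _⊨_ : Interp → List Sentence → Set
  I ⊨ Γ = All (λ φ → evalF I [] φ ≡ true) Γ

  DomPerm : Set
  DomPerm = (s : Sort) → Permutation′ (size s)

  _•_ : DomPerm → Interp → Interp
  fun  (σ • I) g bs = σ (fRes g) ⟨$⟩ʳ fun I g (All.map (λ {s} b → σ s ⟨$⟩ˡ b) bs)
  pred (σ • I) R bs = pred I R (All.map (λ {s} b → σ s ⟨$⟩ˡ b) bs)

  IsDomainSymmetry : List Sentence → DomPerm → Set
  IsDomainSymmetry Γ σ = ∀ (I : Interp) → ((σ • I) ⊨ Γ → I ⊨ Γ) × (I ⊨ Γ → (σ • I) ⊨ Γ)

  Isomorphic : List Sentence → Interp → Interp → Set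
  Isomorphic Γ I I' = Σ DomPerm λ σ → IsDomainSymmetry Γ σ × (I' ≗I (σ • I))

  ValueInterchangeable : List Sentence → (θ : Sort) → (Dom θ → Set) → Set
  ValueInterchangeable Γ θ X =
    ∀ (σ : DomPerm) →
      (∀ v → ¬X v → σ θ ⟨$⟩ʳ v ≡ v) →
      (∀ θ' → θ' ≢ θ → ∀ v → σ θ' ⟨$⟩ʳ v ≡ v) →
      IsDomainSymmetry Γ σ
    where ¬X : Dom θ → Set
          ¬X v = X v → ⊥

  holds1 : (I : Interp) (A : Sort) (Q : PredSym) → pArgs Q ≡ A ∷ [] → Dom A → Bool
  holds1 I A Q hQ v = pred I Q (subst (All Dom) (sym hQ) (v ∷ []))

record Problem : Set where
  field
    sig : Signature
    dom : DomainAssignment sig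
  open Syntax sig dom public
  field
    Γ : List Sentence

-- Interchangeable values may be permuted freely, so it suffices to find a
-- permutation of U(A) moving only the values d₁,…,dₘ after which Q holds on
-- an initial segment of them. Such a permutation is built greedily: if Q holds
-- at some dₖ, swap d₁ with dₖ and recurse on d₂,…,dₘ; otherwise Q holds at none
-- of them and the identity works.
module Submission where

open import Defs
open import Data.Nat using (ℕ; suc; zero)
open import Data.Fin using (Fin; toℕ; zero; suc)
open import Data.Bool using (Bool; true; _≟_)
open import Data.List using (List; _∷_; [])
open import Data.List.Relation.Unary.All as All using (All; []; _∷_)
open import Data.Product using (Σ; _×_; ∃; _,_; proj₁; proj₂)
open import Data.Empty using (⊥-elim)
open import Function using (_∘_)
open import Function.Definitions using (Injective)
open import Relation.Nullary using (yes; no; ¬_)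
open import Relation.Binary.PropositionalEquality
  using (_≡_; _≢_; refl; sym; trans; cong; subst; module ≡-Reasoning)
open import Data.Fin.Permutation using (Permutation′; _⟨$⟩ʳ_; _⟨$⟩ˡ_; transpose; _∘ₚ_; inverseˡ)
import Data.Fin.Permutation as Perm
import Data.Fin.Permutation.Components as PC
import Data.Fin.Properties as FinP
import Data.Nat.Properties as NatP

transpose-matchʳ : ∀ {n} (i j : Fin n) → PC.transpose i j j ≡ i
transpose-matchʳ i j with j FinP.≟ i
... | yes j≡i = j≡i
... | no _ with j FinP.≟ j
...   | yes _ = refl
...   | no j≢j = ⊥-elim (j≢j refl)

transpose-mismatch : ∀ {n} {i j k : Fin n} → k ≢ i → k ≢ j → PC.transpose i j k ≡ k
transpose-mismatch {i = i} {j} {k} k≢i k≢j with k FinP.≟ i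
... | yes k≡i = ⊥-elim (k≢i k≡i)
... | no _ with k FinP.≟ j
...   | yes k≡j = ⊥-elim (k≢j k≡j)
...   | no _ = refl

fixedʳ⇒fixedˡ : ∀ {n} (π : Permutation′ n) {v} → π ⟨$⟩ʳ v ≡ v → π ⟨$⟩ˡ v ≡ v
fixedʳ⇒fixedˡ π {v} πv≡v = trans (cong (π ⟨$⟩ˡ_) (sym πv≡v)) (inverseˡ π)

FixesOutsideImage : ∀ {n m} → Permutation′ n → (Fin m → Fin n) → Set
FixesOutsideImage π d = ∀ v → ¬ (∃ λ i → d i ≡ v) → π ⟨$⟩ʳ v ≡ v

Descending : ∀ {n m} → (Fin n → Bool) → (Fin m → Fin n) → Set
Descending {m = m} q d = ∀ (i j : Fin m) → toℕ j ≡ suc (toℕ i) → q (d j) ≡ true → q (d i) ≡ true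

descending-cong : ∀ {n m} {p q : Fin n → Bool} {d : Fin m → Fin n} →
  (∀ v → p v ≡ q v) → Descending q d → Descending p d
descending-cong {d = d} p≗q desc i j j≡1+i pdj =
  trans (p≗q (d i)) (desc i j j≡1+i (trans (sym (p≗q (d j))) pdj))

descending-cons : ∀ {n m} {q : Fin n → Bool} {d : Fin (suc m) → Fin n} →
  q (d zero) ≡ true → Descending q (d ∘ suc) → Descending q d
descending-cons qd₀ desc zero    (suc zero)    _     _ = qd₀
descending-cons qd₀ desc (suc i) (suc j)       j≡1+i   = desc i j (NatP.suc-injective j≡1+i)
descending-cons qd₀ desc zero    zero          ()
descending-cons qd₀ desc zero    (suc (suc j)) ()
descending-cons qd₀ desc (suc i) zero          ()

sortingPermutation : ∀ {n} (q : Fin n → Bool) m (d : Fin m → Fin n) → Injective _≡_ _≡_ d →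
  Σ (Permutation′ n) λ π → FixesOutsideImage π d × Descending (q ∘ (π ⟨$⟩ˡ_)) d
sortingPermutation q zero d _ = Perm.id , (λ _ _ → refl) , (λ ())
sortingPermutation q (suc m) d d-inj with FinP.any? (λ k → q (d k) ≟ true)
... | no ¬qd = Perm.id , (λ _ _ → refl) , (λ _ j _ qdj → ⊥-elim (¬qd (j , qdj)))
... | yes (k , qdₖ) =
  τ ∘ₚ ρ , fixes , descending-cons {q = q ∘ ((τ ∘ₚ ρ) ⟨$⟩ˡ_)} {d = d} qπd₀ descending
  where
  τ = transpose (d zero) (d k)
  tail = sortingPermutation (q ∘ (τ ⟨$⟩ˡ_)) m (d ∘ suc) (FinP.suc-injective ∘ d-inj)
  ρ = proj₁ tail
  ρ-fixes = proj₁ (proj₂ tail)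
  descending = proj₂ (proj₂ tail)

  fixes : FixesOutsideImage (τ ∘ₚ ρ) d
  fixes v v∉d = trans
    (cong (ρ ⟨$⟩ʳ_) (transpose-mismatch (λ v≡ → v∉d (zero , sym v≡)) (λ v≡ → v∉d (k , sym v≡))))
    (ρ-fixes v (λ { (i , dᵢ≡v) → v∉d (suc i , dᵢ≡v) }))

  ρ-fixes-d₀ : ρ ⟨$⟩ˡ d zero ≡ d zero
  ρ-fixes-d₀ = fixedʳ⇒fixedˡ ρ (ρ-fixes (d zero) λ { (_ , e) → FinP.0≢1+n (sym (d-inj e)) })

  qπd₀ : q (τ ⟨$⟩ˡ (ρ ⟨$⟩ˡ d zero)) ≡ true
  qπd₀ = begin
    q (τ ⟨$⟩ˡ (ρ ⟨$⟩ˡ d zero)) ≡⟨ cong (q ∘ (τ ⟨$⟩ˡ_)) ρ-fixes-d₀ ⟩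
    q (PC.transpose (d k) (d zero) (d zero)) ≡⟨ cong q (transpose-matchʳ (d k) (d zero)) ⟩
    q (d k) ≡⟨ qdₖ ⟩
    true ∎
    where open ≡-Reasoning

module _ {s : ℕ} (size : Fin s → ℕ) (A : Fin s) (π : Permutation′ (size A)) where
  permuteOnly : (θ : Fin s) → Permutation′ (size θ)
  permuteOnly θ with θ FinP.≟ A
  ... | yes refl = π
  ... | no _ = Perm.id

  permuteOnly-at : permuteOnly A ≡ π
  permuteOnly-at with A FinP.≟ A
  ... | yes refl = refl
  ... | no A≢A = ⊥-elim (A≢A refl)

  permuteOnly-elsewhere : ∀ θ → θ ≢ A → ∀ v → permuteOnly θ ⟨$⟩ʳ v ≡ v
  permuteOnly-elsewhere θ θ≢A v with θ FinP.≟ A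
  ... | yes θ≡A = ⊥-elim (θ≢A θ≡A)
  ... | no _ = refl

map-subst-singleton : ∀ {s} {D : Fin s → Set} (f : ∀ {θ} → D θ → D θ) {A : Fin s} {L : List (Fin s)}
  (e : L ≡ A ∷ []) (v : D A) →
  All.map f (subst (All D) (sym e) (v ∷ [])) ≡ subst (All D) (sym e) (f v ∷ [])
map-subst-singleton f refl v = refl

module _ (P : Problem) where
  open Problem P

  holds1-• : ∀ (σ : DomPerm) I A Q (hQ : Signature.pArgs sig Q ≡ A ∷ []) v →
    holds1 (σ • I) A Q hQ v ≡ holds1 I A Q hQ (σ A ⟨$⟩ˡ v)
  holds1-• σ I A Q hQ v = cong (pred I Q) (map-subst-singleton (λ {θ} → σ θ ⟨$⟩ˡ_) hQ v)

mainTheorem11 : (P : Problem) → let open Problem P in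
    (A : Signature.Sort sig) (Q : Signature.PredSym sig) (hQ : Signature.pArgs sig Q ≡ A ∷ []) →
    (m : ℕ) (d : Fin m → DomainAssignment.Dom dom A) → Injective _≡_ _≡_ d →
    ValueInterchangeable Γ A (λ v → ∃ λ i → d i ≡ v) →
    (I : Interp) →
    Σ Interp λ I' → Isomorphic Γ I I' ×
    (∀ (i j : Fin m) → toℕ j ≡ suc (toℕ i) →
    holds1 I' A Q hQ (d j) ≡ true → holds1 I' A Q hQ (d i) ≡ true)
mainTheorem11 P A Q hQ m d d-inj interchangeable I =
  σ • I , (σ , σ-symmetry , (λ _ _ → refl) , (λ _ _ → refl)) , descending-cong holds π-sorts
  where
  open Problem P
  size = DomainAssignment.size dom
  q = holds1 I A Q hQ
  sorting = sortingPermutation q m d d-inj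
  π = proj₁ sorting
  π-fixes = proj₁ (proj₂ sorting)
  π-sorts = proj₂ (proj₂ sorting)
  σ = permuteOnly size A π

  σ-fixes : ∀ v → ¬ (∃ λ i → d i ≡ v) → σ A ⟨$⟩ʳ v ≡ v
  σ-fixes v v∉d = trans (cong (_⟨$⟩ʳ v) (permuteOnly-at size A π)) (π-fixes v v∉d)

  σ-symmetry : IsDomainSymmetry Γ σ
  σ-symmetry = interchangeable σ σ-fixes (permuteOnly-elsewhere size A π)

  holds : ∀ v → holds1 (σ • I) A Q hQ v ≡ q (π ⟨$⟩ˡ v)
  holds v = trans (holds1-• P σ I A Q hQ v)
    (cong (λ π′ → q (π′ ⟨$⟩ˡ v)) (permuteOnly-at size A π))
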